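{- Let $n\ge0$ and let $\frac{p}{q}$ and $\frac{r}{s}$ be consecutive terms of $SB_n$ (in lowest terms, positive denominators). Then each of $\gcd(2p+r,2q+s)$ and $\gcd(p+2r,q+2s)$ is equal to $1$ or $3$; that is, when a newly inserted mediant reduces non-trivially, it reduces by a factor of exactly $3$.
   Context: The unit weight-$3$ Stern–Brocot sequences $SB_n$ ($n\ge0$): $SB_0=(\frac{0}{1},\frac{1}{1})$, and $SB_{n+1}$ is obtained from $SB_n$ by keeping all its terms in order and inserting, between each pair of consecutive terms $\frac{p}{q},\frac{r}{s}$ (in lowest terms, positive denominators), the two fractions $\frac{2p+r}{2q+s}$ and $\frac{p+2r}{q+2s}$, each reduced to lowest terms, in this order. -}

module Defs where

open import Data.Nat using (ℕ; zero; suc; _+_; _*_; _/_)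
open import Data.Nat.GCD using (gcd)
open import Data.Product using (_×_; _,_)
open import Data.List using (List; []; _∷_)

Frac : Set
Frac = ℕ × ℕ

-- Reduction to lowest terms: divide numerator and denominator by their gcd.
-- (When the gcd is 0, i.e. 0/0, which never occurs here, the pair is left alone.)
reduce : Frac → Frac
reduce (a , b) with gcd a b
... | zero  = (a , b)
... | suc g = (a / suc g , b / suc g)

med₁ : Frac → Frac → Frac
med₁ (p , q) (r , s) = (2 * p + r , 2 * q + s)

med₂ : Frac → Frac → Frac
med₂ (p , q) (r , s) = (p + 2 * r , q + 2 * s)

step : List Frac → List Frac
step []           = []
step (x ∷ [])     = x ∷ []
step (x ∷ y ∷ xs) = x ∷ reduce (med₁ x y) ∷ reduce (med₂ x y) ∷ step (y ∷ xs)

SB : ℕ → List Frac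
SB zero    = (0 , 1) ∷ (1 , 1) ∷ []
SB (suc n) = step (SB n)

{-# OPTIONS --safe #-}
-- View fractions as vectors of ℤ². Call u, v adjacent if v = u + 3ᵏw or v = 3ᵏw − u for some
-- k and some w with det(w, u) = 1, i.e. v ≡ ±u (mod 3ᵏ) with w completing u to a basis.
-- 0/1, 1/1 are adjacent, and for adjacent u, v each mediant 2u + v, u + 2v is either
-- primitive or 3 times a primitive vector: for v = u + 3ᵏ⁺¹w they are 3(u + 3ᵏw) and
-- 3(u + 2·3ᵏw); for v = 3ᵏw − u they are u + 3ᵏw and 2·3ᵏw − u. Moreover u, the two
-- reduced mediants and v are again pairwise adjacent, so adjacency holds along every SBₙ.
-- Primitive vectors have coprime coordinates, which leaves gcd 1 or 3.
module Submission where

open import Defs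
open import Data.Nat using (ℕ; zero; suc; _<_; s≤s)
open import Data.Nat.Properties using (<-trans; n<1+n)
open import Data.Nat.GCD using (gcd)
open import Data.Fin using (fromℕ<)
open import Data.List using ([]; _∷_; length; lookup)
open import Data.List.Relation.Unary.Linked using (Linked; []; [-]; _∷_)
open import Data.Product using (_×_; _,_; ∃; proj₁; proj₂; uncurry)
open import Data.Sum using (_⊎_; inj₁; inj₂)
open import Level using (Level; 0ℓ)
open import Relation.Binary using (Rel)
open import Relation.Binary.PropositionalEquality

module _ {ℓ : Level} {R : Rel Frac ℓ}
         (splits : ∀ {x y} → R x y → R x (reduce (med₁ x y)) ×
                     R (reduce (med₁ x y)) (reduce (med₂ x y)) × R (reduce (med₂ x y)) y)
         where

  private
    insert : ∀ {x y ys} → R x y → Linked R (y ∷ ys) →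
             Linked R (x ∷ reduce (med₁ x y) ∷ reduce (med₂ x y) ∷ y ∷ ys)
    insert x~y rest with splits x~y
    ... | x~m₁ , m₁~m₂ , m₂~y = x~m₁ ∷ m₁~m₂ ∷ m₂~y ∷ rest

  step-Linked : ∀ {xs} → Linked R xs → Linked R (step xs)
  step-Linked []                   = []
  step-Linked [-]                  = [-]
  step-Linked (x~y ∷ [-])          = insert x~y [-]
  step-Linked (x~y ∷ rest@(_ ∷ _)) = insert x~y (step-Linked rest)

module _ {a ℓ : Level} {A : Set a} {R : Rel A ℓ} where

  Linked-lookup : ∀ {xs} i (h : suc i < length xs) → Linked R xs →
                  R (lookup xs (fromℕ< (<-trans (n<1+n i) h))) (lookup xs (fromℕ< h))
  Linked-lookup i       (s≤s ()) [-]
  Linked-lookup zero    h        (x~y ∷ _)  = x~y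
  Linked-lookup (suc i) (s≤s h)  (_ ∷ rest) = Linked-lookup i h rest

module Lattice where

  open import Data.Nat as ℕ using ()
  open import Data.Nat.Divisibility using (∣1⇒≡1)
  open import Data.Nat.DivMod using (_/_; n/1≡n; m*n/n≡m)
  open import Data.Nat.GCD using (gcd[m,n]∣m; gcd[m,n]∣n; c*gcd[m,n]≡gcd[cm,cn])
  open import Data.Nat.Properties using (*-comm)
  open import Data.Integer using (ℤ; +_; -[1+_]; _+_; _*_; -_; _-_; _^_)
  open import Data.Integer.Properties using (pos-+; pos-*; +-injective)
  open import Data.Integer.Divisibility.Signed
    using (_∣_; ∣ᵤ⇒∣; ∣⇒∣ᵤ; ∣m∣n⇒∣m-n; ∣m⇒∣m*n)
  open import Data.Integer.Tactic.RingSolver using (solve-∀)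

  ℤ² : Set
  ℤ² = ℤ × ℤ

  infixl 6 _+ᵥ_ _-ᵥ_
  infixl 7 _·_

  _+ᵥ_ _-ᵥ_ : ℤ² → ℤ² → ℤ²
  (a , b) +ᵥ (c , d) = a + c , b + d
  (a , b) -ᵥ (c , d) = a - c , b - d

  _·_ : ℤ → ℤ² → ℤ²
  k · (a , b) = k * a , k * b

  -ᵥ_ : ℤ² → ℤ²
  -ᵥ (a , b) = - a , - b

  det : ℤ² → ℤ² → ℤ
  det (a , b) (c , d) = a * d - b * c

  embed : Frac → ℤ²
  embed (a , b) = + a , + b

  mediant₁ mediant₂ : ℤ² → ℤ² → ℤ²
  mediant₁ u v = + 2 · u +ᵥ v
  mediant₂ u v = u +ᵥ + 2 · v

  Primitive : ℤ² → Set
  Primitive u = ∃ λ w → det u w ≡ + 1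

  det-shiftʳ : ∀ u w c → det w (u +ᵥ c · w) ≡ det w u
  det-shiftʳ (p , q) (x , y) c = identity p q x y c
    where
    identity : ∀ p q x y c → x * (q + c * y) - y * (p + c * x) ≡ x * q - y * p
    identity = solve-∀

  det-shiftˡ : ∀ u w c → det (w +ᵥ c · u) u ≡ det w u
  det-shiftˡ (p , q) (x , y) c = identity p q x y c
    where
    identity : ∀ p q x y c → (x + c * p) * q - (y + c * q) * p ≡ x * q - y * p
    identity = solve-∀

  det-reflect : ∀ u w c → det (-ᵥ w) (c · w -ᵥ u) ≡ det w u
  det-reflect (p , q) (x , y) c = identity p q x y c
    where
    identity : ∀ p q x y c → - x * (c * y - q) - - y * (c * x - p) ≡ x * q - y * p
    identity = solve-∀

  primitive-shift : ∀ u w c → det w u ≡ + 1 → Primitive (u +ᵥ c · w)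
  primitive-shift (p , q) (x , y) c D = (- x , - y) , trans (identity p q x y c) D
    where
    identity : ∀ p q x y c → (p + c * x) * - y - (q + c * y) * - x ≡ x * q - y * p
    identity = solve-∀

  primitive-reflect : ∀ u w c → det w u ≡ + 1 → Primitive (c · w -ᵥ u)
  primitive-reflect (p , q) (x , y) c D = (x , y) , trans (identity p q x y c) D
    where
    identity : ∀ p q x y c → (c * x - p) * y - (c * y - q) * x ≡ x * q - y * p
    identity = solve-∀

  data Adjacent (u v : ℤ²) : Set where
    shift   : ∀ k w → det w u ≡ + 1 → v ≡ u +ᵥ ((+ 3) ^ k) · w → Adjacent u v
    reflect : ∀ k w → det w u ≡ + 1 → v ≡ ((+ 3) ^ k) · w -ᵥ u → Adjacent u v

  data ReducesTo (v x : ℤ²) : Set where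
    by-1 : Primitive x → v ≡ x → ReducesTo v x
    by-3 : Primitive x → v ≡ + 3 · x → ReducesTo v x

  record Refinement (u v : ℤ²) : Set where
    field
      x₁ x₂    : ℤ²
      reduces₁ : ReducesTo (mediant₁ u v) x₁
      reduces₂ : ReducesTo (mediant₂ u v) x₂
      u~x₁     : Adjacent u x₁
      x₁~x₂    : Adjacent x₁ x₂
      x₂~v     : Adjacent x₂ v

  refine-reflect : ∀ {u v} k w → det w u ≡ + 1 → v ≡ ((+ 3) ^ k) · w -ᵥ u → Refinement u v
  refine-reflect {u@(p , q)} k w@(x , y) D refl = record
    { x₁       = u +ᵥ c · w
    ; x₂       = (+ 2 * c) · w -ᵥ u
    ; reduces₁ = by-1 (primitive-shift u w c D) (cong₂ _,_ (mediant₁≡ c p x) (mediant₁≡ c q y))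
    ; reduces₂ = by-1 (primitive-reflect u w (+ 2 * c) D) (cong₂ _,_ (mediant₂≡ c p x) (mediant₂≡ c q y))
    ; u~x₁     = shift k w D refl
    ; x₁~x₂    = reflect (suc k) w (trans (det-shiftʳ u w c) D)
                   (cong₂ _,_ (x₂≡ c p x) (x₂≡ c q y))
    ; x₂~v     = shift k (-ᵥ w) (trans (det-reflect u w (+ 2 * c)) D)
                   (cong₂ _,_ (v≡ c p x) (v≡ c q y))
    }
    where
    c : ℤ
    c = (+ 3) ^ k
    mediant₁≡ : ∀ c p x → + 2 * p + (c * x - p) ≡ p + c * x
    mediant₁≡ = solve-∀
    mediant₂≡ : ∀ c p x → p + + 2 * (c * x - p) ≡ + 2 * c * x - p
    mediant₂≡ = solve-∀
    x₂≡ : ∀ c p x → + 2 * c * x - p ≡ + 3 * c * x - (p + c * x)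
    x₂≡ = solve-∀
    v≡ : ∀ c p x → c * x - p ≡ + 2 * c * x - p + c * - x
    v≡ = solve-∀

  refine-shift : ∀ {u v} k w → det w u ≡ + 1 → v ≡ u +ᵥ ((+ 3) ^ suc k) · w → Refinement u v
  refine-shift {u@(p , q)} k w@(x , y) D refl = record
    { x₁       = u +ᵥ c · w
    ; x₂       = u +ᵥ (+ 2 * c) · w
    ; reduces₁ = by-3 (primitive-shift u w c D) (cong₂ _,_ (mediant₁≡ c p x) (mediant₁≡ c q y))
    ; reduces₂ = by-3 (primitive-shift u w (+ 2 * c) D) (cong₂ _,_ (mediant₂≡ c p x) (mediant₂≡ c q y))
    ; u~x₁     = shift k w D refl
    ; x₁~x₂    = shift k w (trans (det-shiftʳ u w c) D) (cong₂ _,_ (x₂≡ c p x) (x₂≡ c q y))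
    ; x₂~v     = shift k w (trans (det-shiftʳ u w (+ 2 * c)) D) (cong₂ _,_ (v≡ c p x) (v≡ c q y))
    }
    where
    c : ℤ
    c = (+ 3) ^ k
    mediant₁≡ : ∀ c p x → + 2 * p + (p + + 3 * c * x) ≡ + 3 * (p + c * x)
    mediant₁≡ = solve-∀
    mediant₂≡ : ∀ c p x → p + + 2 * (p + + 3 * c * x) ≡ + 3 * (p + + 2 * c * x)
    mediant₂≡ = solve-∀
    x₂≡ : ∀ c p x → p + + 2 * c * x ≡ p + c * x + c * x
    x₂≡ = solve-∀
    v≡ : ∀ c p x → p + + 3 * c * x ≡ p + + 2 * c * x + c * x
    v≡ = solve-∀

  refine : ∀ {u v} → Adjacent u v → Refinement u v
  -- A shift by 3⁰ = 1 is also a reflection: u + w = (w + 2u) − u.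
  refine {u} (shift zero w D e) =
    refine-reflect 0 (w +ᵥ + 2 · u) (trans (det-shiftˡ u w (+ 2)) D) (trans e (recentre u w))
    where
    recentre : ∀ u w → u +ᵥ + 1 · w ≡ + 1 · (w +ᵥ + 2 · u) -ᵥ u
    recentre (p , q) (x , y) = cong₂ _,_ (identity p x) (identity q y)
      where
      identity : ∀ p x → p + + 1 * x ≡ + 1 * (x + + 2 * p) - p
      identity = solve-∀
  refine (shift (suc k) w D e) = refine-shift k w D e
  refine (reflect k w D e)     = refine-reflect k w D e

  primitive⇒coprime : ∀ a b → Primitive (embed (a , b)) → gcd a b ≡ 1
  primitive⇒coprime a b ((α , β) , D) = ∣1⇒≡1 (∣⇒∣ᵤ (subst (+ gcd a b ∣_) D g∣det))
    where
    g∣det : + gcd a b ∣ + a * β - + b * α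
    g∣det = ∣m∣n⇒∣m-n (∣m⇒∣m*n β (∣ᵤ⇒∣ {i = + a} (gcd[m,n]∣m a b)))
                      (∣m⇒∣m*n α (∣ᵤ⇒∣ {i = + b} (gcd[m,n]∣n a b)))

  reduce-by-gcd : ∀ a b {g} → gcd a b ≡ suc g → reduce (a , b) ≡ (a / suc g , b / suc g)
  reduce-by-gcd a b eq with gcd a b | eq
  ... | _ | refl = refl

  reduce-coprime : ∀ a b → gcd a b ≡ 1 → reduce (a , b) ≡ (a , b)
  reduce-coprime a b g≡1 = trans (reduce-by-gcd a b g≡1) (cong₂ _,_ (n/1≡n a) (n/1≡n b))

  gcd-triple : ∀ a b → gcd a b ≡ 1 → gcd (3 ℕ.* a) (3 ℕ.* b) ≡ 3
  gcd-triple a b g≡1 = trans (sym (c*gcd[m,n]≡gcd[cm,cn] 3 a b)) (cong (3 ℕ.*_) g≡1)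

  reduce-triple : ∀ a b → gcd a b ≡ 1 → reduce (3 ℕ.* a , 3 ℕ.* b) ≡ (a , b)
  reduce-triple a b g≡1 =
    trans (reduce-by-gcd (3 ℕ.* a) (3 ℕ.* b) (gcd-triple a b g≡1)) (cong₂ _,_ (3*m/3≡m a) (3*m/3≡m b))
    where
    3*m/3≡m : ∀ m → 3 ℕ.* m / 3 ≡ m
    3*m/3≡m m = trans (cong (_/ 3) (*-comm 3 m)) (m*n/n≡m m 3)

  OneOrThree : ℕ → Set
  OneOrThree g = g ≡ 1 ⊎ g ≡ 3

  reducesTo-reduce : ∀ m {x} → ReducesTo (embed m) x → OneOrThree (uncurry gcd m) × embed (reduce m) ≡ x
  reducesTo-reduce (a , b) (by-1 prim refl) = inj₁ g≡1 , cong embed (reduce-coprime a b g≡1)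
    where
    g≡1 = primitive⇒coprime a b prim
  reducesTo-reduce (a , b) { + x , + y } (by-3 prim e)
    with refl ← +-injective (trans (cong proj₁ e) (sym (pos-* 3 x)))
       | refl ← +-injective (trans (cong proj₂ e) (sym (pos-* 3 y))) =
    inj₂ (gcd-triple x y g≡1) , cong embed (reduce-triple x y g≡1)
    where
    g≡1 = primitive⇒coprime x y prim
  reducesTo-reduce _ { + _ , -[1+ _ ] } (by-3 _ ())
  reducesTo-reduce _ { -[1+ _ ] , _ } (by-3 _ ())

  embed-med₁ : ∀ x y → embed (med₁ x y) ≡ mediant₁ (embed x) (embed y)
  embed-med₁ (p , q) (r , s) = cong₂ _,_ (pos-2*m+n p r) (pos-2*m+n q s)
    where
    pos-2*m+n : ∀ m n → + (2 ℕ.* m ℕ.+ n) ≡ + 2 * + m + + n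
    pos-2*m+n m n = trans (pos-+ (2 ℕ.* m) n) (cong (_+ + n) (pos-* 2 m))

  embed-med₂ : ∀ x y → embed (med₂ x y) ≡ mediant₂ (embed x) (embed y)
  embed-med₂ (p , q) (r , s) = cong₂ _,_ (pos-m+2*n p r) (pos-m+2*n q s)
    where
    pos-m+2*n : ∀ m n → + (m ℕ.+ 2 ℕ.* n) ≡ + m + + 2 * + n
    pos-m+2*n m n = trans (pos-+ m (2 ℕ.* n)) (cong (_+_ (+ m)) (pos-* 2 n))

  Neighbours : Rel Frac 0ℓ
  Neighbours x y = Adjacent (embed x) (embed y)

  module _ {x y : Frac} (x~y : Neighbours x y) where

    open Refinement (refine x~y)

    private
      med₁-reduces : OneOrThree (uncurry gcd (med₁ x y)) × embed (reduce (med₁ x y)) ≡ x₁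
      med₁-reduces = reducesTo-reduce (med₁ x y) (subst (λ m → ReducesTo m x₁) (sym (embed-med₁ x y)) reduces₁)

      med₂-reduces : OneOrThree (uncurry gcd (med₂ x y)) × embed (reduce (med₂ x y)) ≡ x₂
      med₂-reduces = reducesTo-reduce (med₂ x y) (subst (λ m → ReducesTo m x₂) (sym (embed-med₂ x y)) reduces₂)

    mediant-gcds : OneOrThree (uncurry gcd (med₁ x y)) × OneOrThree (uncurry gcd (med₂ x y))
    mediant-gcds = proj₁ med₁-reduces , proj₁ med₂-reduces

    neighbours-refine : Neighbours x (reduce (med₁ x y)) ×
                        Neighbours (reduce (med₁ x y)) (reduce (med₂ x y)) ×
                        Neighbours (reduce (med₂ x y)) y
    neighbours-refine =
      subst (Adjacent (embed x)) (sym m₁≡x₁) u~x₁ ,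
      subst₂ Adjacent (sym m₁≡x₁) (sym m₂≡x₂) x₁~x₂ ,
      subst (λ z → Adjacent z (embed y)) (sym m₂≡x₂) x₂~v
      where
      m₁≡x₁ = proj₂ med₁-reduces
      m₂≡x₂ = proj₂ med₂-reduces

  SB-Linked : ∀ n → Linked Neighbours (SB n)
  SB-Linked zero    = shift 0 (+ 1 , + 0) refl refl ∷ [-]
  SB-Linked (suc n) = step-Linked neighbours-refine (SB-Linked n)

open Lattice using (Neighbours; SB-Linked; mediant-gcds)
open import Data.Nat using (_+_; _*_)

theorem9 : (n i : ℕ) (h : suc i < length (SB n)) (p q r s : ℕ) →
    lookup (SB n) (fromℕ< (<-trans (n<1+n i) h)) ≡ (p , q) →
    lookup (SB n) (fromℕ< h) ≡ (r , s) →
    ((gcd (2 * p + r) (2 * q + s) ≡ 1 ⊎ gcd (2 * p + r) (2 * q + s) ≡ 3)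
    × (gcd (p + 2 * r) (q + 2 * s) ≡ 1 ⊎ gcd (p + 2 * r) (q + 2 * s) ≡ 3))
theorem9 n i h p q r s e₁ e₂ =
  mediant-gcds (subst₂ Neighbours e₁ e₂ (Linked-lookup i h (SB-Linked n)))
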